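{- Let $\alpha$ be a node of a finite-depth Kripke model $\mathcal{K}$ for a first-order language $\mathcal{L}$. Then for every sentence $A$ of $\mathcal{L}(D(\alpha))$, $\mathcal{K}'_\alpha,\alpha\Vdash A$ iff $\mathcal{K},\alpha\Vdash A$.
   Context: A Kripke model is $\mathcal{K}=(K,\leq,D,\Vdash)$ with $(K,\leq)$ a nonempty poset, nonempty domains increasing along $\leq$, and $\Vdash$ a monotone forcing of atomic sentences of $\mathcal{L}(D(\alpha))$ extended in the standard intuitionistic way. The depth of a model is the maximum $n$ such that no chain in $(K,\leq)$ is longer than $n$; finite depth means such $n$ exists. A node $\beta$ is classical if $\beta\Vdash\forall\bar x(A\vee\neg A)$ for every formula $A$ of $\mathcal{L}(D(\beta))$ with free variables among $\bar x$. $\mathcal{K}'_\alpha$ is the restriction of $\mathcal{K}$ (same domains and atomic forcing) to the set of nodes $\{\alpha\}\cup\{\beta>\alpha:\beta\text{ not classical}\}\cup\{\beta>\alpha:\beta\text{ is maximal in }K\}$. $\mathcal{M},\alpha\Vdash A$ means node $\alpha$ forces $A$ in model $\mathcal{M}$. -}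

module Defs where

open import Level using (0ℓ)
open import Data.Nat using (ℕ; zero; suc; _+_; _≤_)
open import Data.Fin using (Fin; inject₁) renaming (zero to fzero; suc to fsuc)
open import Data.Vec using (Vec; []; _∷_)
import Data.Vec
open import Data.Vec.Functional using () renaming (_∷_ to _∷ᶠ_)
open import Data.Product using (Σ; ∃; _×_; _,_)
open import Data.Sum using (_⊎_)
open import Data.Unit using (⊤)
open import Data.Empty using (⊥)
open import Relation.Nullary using (¬_)
open import Relation.Binary.PropositionalEquality using (_≡_; _≢_)
open import Relation.Binary.Structures using (IsPartialOrder)

-- First-order languages: function symbols (constants = arity 0) and
-- relation symbols (equality, if present, is an ordinary relation symbol).

record Signature : Set₁ where
  field
    FSym  : Set
    farity : FSym → ℕ
    RSym  : Set
    rarity : RSym → ℕ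

module Syntax (L : Signature) where
  open Signature L

  data Term (n : ℕ) : Set where
    var : Fin n → Term n
    app : (f : FSym) → Vec (Term n) (farity f) → Term n

  data Formula (n : ℕ) : Set where
    atom : (r : RSym) → Vec (Term n) (rarity r) → Formula n
    ⊥'   : Formula n
    _∧'_ : Formula n → Formula n → Formula n
    _∨'_ : Formula n → Formula n → Formula n
    _⇒'_ : Formula n → Formula n → Formula n
    ∀'   : Formula (suc n) → Formula n
    ∃'   : Formula (suc n) → Formula n

  ¬'_ : ∀ {n} → Formula n → Formula n
  ¬' A = A ⇒' ⊥'

  ∀ⁿ : ∀ k {m} → Formula (k + m) → Formula m
  ∀ⁿ zero    A = A
  ∀ⁿ (suc k) A = ∀ⁿ k (∀' A)

-- Domains are subsets D α of a common carrier U,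
-- increasing along ≤; function symbols are interpreted at each node,
-- preserving D α and compatibly along ≤; atomic forcing is monotone.

record KripkeModel (L : Signature) : Set₁ where
  open Signature L
  field
    K        : Set
    _≤ₖ_     : K → K → Set
    isPO     : IsPartialOrder _≡_ _≤ₖ_
    inhabited : K
    U        : Set
    D        : K → U → Set
    D-nonempty : ∀ α → ∃ λ d → D α d
    D-mono   : ∀ {α β d} → α ≤ₖ β → D α d → D β d
    fun      : K → (f : FSym) → Vec U (farity f) → U
    fun-closed : ∀ α f (xs : Vec U (farity f)) →
                 (∀ i → D α (Data.Vec.lookup xs i)) → D α (fun α f xs)
    fun-mono : ∀ {α β} f (xs : Vec U (farity f)) → α ≤ₖ β →
               (∀ i → D α (Data.Vec.lookup xs i)) → fun α f xs ≡ fun β f xs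
    rel      : K → (r : RSym) → Vec U (rarity r) → Set
    rel-mono : ∀ {α β} r (xs : Vec U (rarity r)) → α ≤ₖ β →
               (∀ i → D α (Data.Vec.lookup xs i)) → rel α r xs → rel β r xs

module Semantics {L : Signature} (M : KripkeModel L) where
  open Signature L
  open Syntax L
  open KripkeModel M

  _<ₖ_ : K → K → Set
  α <ₖ β = α ≤ₖ β × α ≢ β

  IsChain : ∀ {m} → (Fin (suc m) → K) → Set
  IsChain {m} c = ∀ (i : Fin m) → c (inject₁ i) <ₖ c (fsuc i)

  FiniteDepth : Set
  FiniteDepth = ∃ λ n → ∀ m (c : Fin (suc m) → K) → IsChain c → m ≤ n

  Maximal : K → Set
  Maximal β = ∀ γ → β ≤ₖ γ → γ ≡ β

  Env : ℕ → Set
  Env n = Fin n → U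

  mutual
    evalT : ∀ {n} → K → Env n → Term n → U
    evalT α ρ (var i)    = ρ i
    evalT α ρ (app f ts) = fun α f (evalTs α ρ ts)

    evalTs : ∀ {n k} → K → Env n → Vec (Term n) k → Vec U k
    evalTs α ρ []       = []
    evalTs α ρ (t ∷ ts) = evalT α ρ t ∷ evalTs α ρ ts

  -- Forcing in the restriction of M to the node set S
  -- (same domains and atomic forcing; quantification over later nodes
  -- ranges only over nodes in S).  With S = λ _ → ⊤ this is forcing in M.
  Forces : (S : K → Set) → ∀ {n} → K → Formula n → Env n → Set
  Forces S α (atom r ts) ρ = rel α r (evalTs α ρ ts)
  Forces S α ⊥'          ρ = ⊥
  Forces S α (A ∧' B)    ρ = Forces S α A ρ × Forces S α B ρ
  Forces S α (A ∨' B)    ρ = Forces S α A ρ ⊎ Forces S α B ρ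
  Forces S α (A ⇒' B)    ρ =
    ∀ γ → S γ → α ≤ₖ γ → Forces S γ A ρ → Forces S γ B ρ
  Forces S α (∀' A)      ρ =
    ∀ γ → S γ → α ≤ₖ γ → ∀ d → D γ d → Forces S γ A (d ∷ᶠ ρ)
  Forces S α (∃' A)      ρ = Σ U λ d → D α d × Forces S α A (d ∷ᶠ ρ)

  AllNodes : K → Set
  AllNodes _ = ⊤

  _⊩_[_] : ∀ {n} → K → Formula n → Env n → Set
  α ⊩ A [ ρ ] = Forces AllNodes α A ρ

  -- β is classical: β ⊩ ∀x̄ (A ∨ ¬A) for every formula A of L(D(β))
  -- with free variables among x̄ (parameters from D(β) given by ρ)
  Classical : K → Set
  Classical β = ∀ m k (A : Formula (k + m)) (ρ : Env m) →
                (∀ i → D β (ρ i)) → β ⊩ ∀ⁿ k (A ∨' (¬' A)) [ ρ ]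

  K'Nodes : K → K → Set
  K'Nodes α β = (β ≡ α) ⊎ ((α <ₖ β × ¬ Classical β) ⊎ (α <ₖ β × Maximal β))

  _,_⊩'_[_] : ∀ {n} → K → K → Formula n → Env n → Set
  α , β ⊩' A [ ρ ] = Forces (K'Nodes α) β A ρ

-- A classical node γ decides every formula, so it forces A as soon as some
-- node above it does (otherwise it would force ¬A).  Hence removing classical,
-- non-maximal nodes above α does not change forcing at α: a quantifier or
-- implication ranging over a removed node γ can be evaluated instead at a
-- maximal node above γ, which exists by finite depth and is kept in 𝒦'_α.
module Submission where

open import Defs
open import Level using (0ℓ)
open import Axiom.ExcludedMiddle using (ExcludedMiddle)
open import Data.Nat using (ℕ; zero; suc)
open import Data.Nat.Properties using (n≮n)
open import Function.Bundles using (_⇔_; mk⇔)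
open import Data.Fin using (Fin) renaming (zero to fzero; suc to fsuc)
open import Data.Vec using (Vec; []; _∷_; lookup)
open import Data.Vec.Functional using () renaming (_∷_ to _∷ᶠ_)
open import Data.Product using (Σ; _×_; _,_; proj₁)
open import Data.Sum using (_⊎_; inj₁; inj₂)
open import Data.Unit using (tt)
open import Data.Empty using (⊥-elim)
open import Relation.Nullary using (¬_; yes; no)
open import Relation.Binary.PropositionalEquality using (_≡_; refl; sym; trans; cong; cong₂; subst)
open import Relation.Binary.Structures using (IsPartialOrder)

module KripkeFacts {L : Signature} (M : KripkeModel L) where
  open Signature L
  open KripkeModel M
  open Syntax L
  open Semantics M
  open IsPartialOrder isPO using () renaming (refl to ≤ₖ-refl; trans to ≤ₖ-trans)

  _∈Env_ : K → ∀ {n} → Env n → Set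
  γ ∈Env ρ = ∀ i → D γ (ρ i)

  ∈Env-∷ : ∀ {γ n d} {ρ : Env n} → D γ d → γ ∈Env ρ → γ ∈Env (d ∷ᶠ ρ)
  ∈Env-∷ d∈ ρ∈ fzero    = d∈
  ∈Env-∷ d∈ ρ∈ (fsuc i) = ρ∈ i

  ∈Env-mono : ∀ {γ δ n} {ρ : Env n} → γ ≤ₖ δ → γ ∈Env ρ → δ ∈Env ρ
  ∈Env-mono γ≤δ ρ∈ i = D-mono γ≤δ (ρ∈ i)

  mutual
    evalT-∈D : ∀ {γ n} {ρ : Env n} → γ ∈Env ρ → (t : Term n) → D γ (evalT γ ρ t)
    evalT-∈D ρ∈ (var i)        = ρ∈ i
    evalT-∈D {γ} ρ∈ (app f ts) = fun-closed γ f _ (evalTs-∈D ρ∈ ts)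

    evalTs-∈D : ∀ {γ n k} {ρ : Env n} → γ ∈Env ρ → (ts : Vec (Term n) k) →
                ∀ i → D γ (lookup (evalTs γ ρ ts) i)
    evalTs-∈D ρ∈ (t ∷ ts) fzero    = evalT-∈D ρ∈ t
    evalTs-∈D ρ∈ (t ∷ ts) (fsuc i) = evalTs-∈D ρ∈ ts i

  mutual
    evalT-mono : ∀ {γ δ n} {ρ : Env n} → γ ≤ₖ δ → γ ∈Env ρ → (t : Term n) →
                 evalT γ ρ t ≡ evalT δ ρ t
    evalT-mono γ≤δ ρ∈ (var i)    = refl
    evalT-mono γ≤δ ρ∈ (app f ts) =
      trans (fun-mono f _ γ≤δ (evalTs-∈D ρ∈ ts)) (cong (fun _ f) (evalTs-mono γ≤δ ρ∈ ts))

    evalTs-mono : ∀ {γ δ n k} {ρ : Env n} → γ ≤ₖ δ → γ ∈Env ρ → (ts : Vec (Term n) k) →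
                  evalTs γ ρ ts ≡ evalTs δ ρ ts
    evalTs-mono γ≤δ ρ∈ []       = refl
    evalTs-mono γ≤δ ρ∈ (t ∷ ts) = cong₂ _∷_ (evalT-mono γ≤δ ρ∈ t) (evalTs-mono γ≤δ ρ∈ ts)

  ⊩-mono : ∀ {n γ δ} (A : Formula n) {ρ : Env n} → γ ≤ₖ δ → γ ∈Env ρ →
           γ ⊩ A [ ρ ] → δ ⊩ A [ ρ ]
  ⊩-mono (atom r ts) γ≤δ ρ∈ h =
    subst (rel _ r) (evalTs-mono γ≤δ ρ∈ ts) (rel-mono r _ γ≤δ (evalTs-∈D ρ∈ ts) h)
  ⊩-mono ⊥'       γ≤δ ρ∈ ()
  ⊩-mono (A ∧' B) γ≤δ ρ∈ (a , b)  = ⊩-mono A γ≤δ ρ∈ a , ⊩-mono B γ≤δ ρ∈ b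
  ⊩-mono (A ∨' B) γ≤δ ρ∈ (inj₁ a) = inj₁ (⊩-mono A γ≤δ ρ∈ a)
  ⊩-mono (A ∨' B) γ≤δ ρ∈ (inj₂ b) = inj₂ (⊩-mono B γ≤δ ρ∈ b)
  ⊩-mono (A ⇒' B) γ≤δ ρ∈ h = λ ε _ δ≤ε → h ε tt (≤ₖ-trans γ≤δ δ≤ε)
  ⊩-mono (∀' A)   γ≤δ ρ∈ h = λ ε _ δ≤ε → h ε tt (≤ₖ-trans γ≤δ δ≤ε)
  ⊩-mono (∃' A)   γ≤δ ρ∈ (d , d∈ , a) = d , D-mono γ≤δ d∈ , ⊩-mono A γ≤δ (∈Env-∷ d∈ ρ∈) a

  Classical-reflects : ∀ {n γ δ} (A : Formula n) {ρ : Env n} → Classical γ → γ ≤ₖ δ →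
                       γ ∈Env ρ → δ ⊩ A [ ρ ] → γ ⊩ A [ ρ ]
  Classical-reflects {n} A {ρ} cl γ≤δ ρ∈ h with cl n 0 A ρ ρ∈
  ... | inj₁ a  = a
  ... | inj₂ ¬a = ⊥-elim (¬a _ tt γ≤δ h)

  -- Nodes outside S may be skipped by quantifiers as long as they are
  -- classical and S reaches above them.
  ClassicallyCofinal : (K → Set) → Set
  ClassicallyCofinal S = ∀ {β γ} → S β → β ≤ₖ γ →
                         S γ ⊎ (Classical γ × Σ K λ δ → γ ≤ₖ δ × S δ)

  module Restriction (S : K → Set) (cofinal : ClassicallyCofinal S) where
    mutual
      ⊩⇒Forces : ∀ {n} (A : Formula n) {β} {ρ : Env n} → S β → β ∈Env ρ →
                 β ⊩ A [ ρ ] → Forces S β A ρ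
      ⊩⇒Forces (atom r ts) sβ ρ∈ h = h
      ⊩⇒Forces ⊥'          sβ ρ∈ ()
      ⊩⇒Forces (A ∧' B) sβ ρ∈ (a , b)  = ⊩⇒Forces A sβ ρ∈ a , ⊩⇒Forces B sβ ρ∈ b
      ⊩⇒Forces (A ∨' B) sβ ρ∈ (inj₁ a) = inj₁ (⊩⇒Forces A sβ ρ∈ a)
      ⊩⇒Forces (A ∨' B) sβ ρ∈ (inj₂ b) = inj₂ (⊩⇒Forces B sβ ρ∈ b)
      ⊩⇒Forces (A ⇒' B) sβ ρ∈ h γ sγ β≤γ a =
        ⊩⇒Forces B sγ ργ∈ (h γ tt β≤γ (Forces⇒⊩ A sγ ργ∈ a))
        where ργ∈ = ∈Env-mono β≤γ ρ∈
      ⊩⇒Forces (∀' A) sβ ρ∈ h γ sγ β≤γ d d∈ =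
        ⊩⇒Forces A sγ (∈Env-∷ d∈ (∈Env-mono β≤γ ρ∈)) (h γ tt β≤γ d d∈)
      ⊩⇒Forces (∃' A) sβ ρ∈ (d , d∈ , a) = d , d∈ , ⊩⇒Forces A sβ (∈Env-∷ d∈ ρ∈) a

      Forces⇒⊩ : ∀ {n} (A : Formula n) {β} {ρ : Env n} → S β → β ∈Env ρ →
                 Forces S β A ρ → β ⊩ A [ ρ ]
      Forces⇒⊩ (atom r ts) sβ ρ∈ h = h
      Forces⇒⊩ ⊥'          sβ ρ∈ ()
      Forces⇒⊩ (A ∧' B) sβ ρ∈ (a , b)  = Forces⇒⊩ A sβ ρ∈ a , Forces⇒⊩ B sβ ρ∈ b
      Forces⇒⊩ (A ∨' B) sβ ρ∈ (inj₁ a) = inj₁ (Forces⇒⊩ A sβ ρ∈ a)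
      Forces⇒⊩ (A ∨' B) sβ ρ∈ (inj₂ b) = inj₂ (Forces⇒⊩ B sβ ρ∈ b)
      Forces⇒⊩ (A ⇒' B) sβ ρ∈ h γ _ β≤γ a with cofinal sβ β≤γ
      ... | inj₁ sγ = Forces⇒⊩ B sγ ργ∈ (h γ sγ β≤γ (⊩⇒Forces A sγ ργ∈ a))
        where ργ∈ = ∈Env-mono β≤γ ρ∈
      ... | inj₂ (cl , δ , γ≤δ , sδ) =
        Classical-reflects B cl γ≤δ ργ∈
          (Forces⇒⊩ B sδ ρδ∈ (h δ sδ (≤ₖ-trans β≤γ γ≤δ) (⊩⇒Forces A sδ ρδ∈ (⊩-mono A γ≤δ ργ∈ a))))
        where ργ∈ = ∈Env-mono β≤γ ρ∈
              ρδ∈ = ∈Env-mono γ≤δ ργ∈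
      Forces⇒⊩ (∀' A) sβ ρ∈ h γ _ β≤γ d d∈ with cofinal sβ β≤γ
      ... | inj₁ sγ = Forces⇒⊩ A sγ (∈Env-∷ d∈ (∈Env-mono β≤γ ρ∈)) (h γ sγ β≤γ d d∈)
      ... | inj₂ (cl , δ , γ≤δ , sδ) =
        Classical-reflects A cl γ≤δ dργ∈
          (Forces⇒⊩ A sδ (∈Env-mono γ≤δ dργ∈) (h δ sδ (≤ₖ-trans β≤γ γ≤δ) d (D-mono γ≤δ d∈)))
        where dργ∈ = ∈Env-∷ d∈ (∈Env-mono β≤γ ρ∈)
      Forces⇒⊩ (∃' A) sβ ρ∈ (d , d∈ , a) = d , d∈ , Forces⇒⊩ A sβ (∈Env-∷ d∈ ρ∈) a

  module WithExcludedMiddle (lem : ExcludedMiddle 0ℓ) where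

    ¬Maximal⇒successor : ∀ β → ¬ Maximal β → Σ K λ γ → β <ₖ γ
    ¬Maximal⇒successor β ¬max with lem {Σ K λ γ → β <ₖ γ}
    ... | yes succ = succ
    ... | no ¬succ = ⊥-elim (¬max above≡β)
      where
      above≡β : ∀ γ → β ≤ₖ γ → γ ≡ β
      above≡β γ β≤γ with lem {γ ≡ β}
      ... | yes γ≡β = γ≡β
      ... | no γ≢β  = ⊥-elim (¬succ (γ , β≤γ , λ β≡γ → γ≢β (sym β≡γ)))

    MaximalAbove : K → Set
    MaximalAbove β = Σ K λ δ → β ≤ₖ δ × Maximal δ

    chain-from : ∀ k β → ¬ MaximalAbove β →
                 Σ (Fin (suc k) → K) λ c → IsChain c × c fzero ≡ β
    chain-from zero    β _ = (λ _ → β) , (λ ()) , refl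
    chain-from (suc k) β ¬maxAbove with ¬Maximal⇒successor β (λ max → ¬maxAbove (β , ≤ₖ-refl , max))
    ... | γ , β<γ with chain-from k γ (λ { (δ , γ≤δ , max) → ¬maxAbove (δ , ≤ₖ-trans (proj₁ β<γ) γ≤δ , max) })
    ... | c , c-chain , c₀≡γ = (β ∷ᶠ c) , βc-chain , refl
      where
      βc-chain : IsChain (β ∷ᶠ c)
      βc-chain fzero    = subst (β <ₖ_) (sym c₀≡γ) β<γ
      βc-chain (fsuc i) = c-chain i

    FiniteDepth⇒maximalAbove : FiniteDepth → ∀ β → MaximalAbove β
    FiniteDepth⇒maximalAbove (depth , bounded) β with lem {MaximalAbove β}
    ... | yes maxAbove = maxAbove
    ... | no ¬maxAbove with chain-from (suc depth) β ¬maxAbove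
    ... | c , c-chain , _ = ⊥-elim (n≮n depth (bounded (suc depth) c c-chain))

    K'Nodes-intro : ∀ {α γ} → α ≤ₖ γ → (¬ Classical γ) ⊎ Maximal γ → K'Nodes α γ
    K'Nodes-intro {α} {γ} α≤γ kept with lem {γ ≡ α} | kept
    ... | yes γ≡α | _        = inj₁ γ≡α
    ... | no γ≢α  | inj₁ ¬cl = inj₂ (inj₁ ((α≤γ , λ α≡γ → γ≢α (sym α≡γ)) , ¬cl))
    ... | no γ≢α  | inj₂ max = inj₂ (inj₂ ((α≤γ , λ α≡γ → γ≢α (sym α≡γ)) , max))

    K'Nodes-above : ∀ {α β} → K'Nodes α β → α ≤ₖ β
    K'Nodes-above (inj₁ refl)                   = ≤ₖ-refl
    K'Nodes-above (inj₂ (inj₁ ((α≤β , _) , _))) = α≤β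
    K'Nodes-above (inj₂ (inj₂ ((α≤β , _) , _))) = α≤β

    K'Nodes-classicallyCofinal : FiniteDepth → ∀ α → ClassicallyCofinal (K'Nodes α)
    K'Nodes-classicallyCofinal fd α {γ = γ} sβ β≤γ with lem {Classical γ}
    ... | no ¬cl = inj₁ (K'Nodes-intro α≤γ (inj₁ ¬cl))
      where α≤γ = ≤ₖ-trans (K'Nodes-above sβ) β≤γ
    ... | yes cl with FiniteDepth⇒maximalAbove fd γ
    ... | δ , γ≤δ , max =
      inj₂ (cl , δ , γ≤δ , K'Nodes-intro (≤ₖ-trans (K'Nodes-above sβ) (≤ₖ-trans β≤γ γ≤δ)) (inj₂ max))

mainTheorem10 : ExcludedMiddle 0ℓ →
    (L : Signature) (M : KripkeModel L) →
    let open KripkeModel M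
        open Syntax L
        open Semantics M
    in FiniteDepth → (α : K) →
       ∀ (n : ℕ) (A : Formula n) (ρ : Env n) → (∀ i → D α (ρ i)) →
       ((α , α ⊩' A [ ρ ]) ⇔ (α ⊩ A [ ρ ]))
mainTheorem10 lem L M fd α n A ρ ρ∈ =
  mk⇔ (Forces⇒⊩ A (inj₁ refl) ρ∈) (⊩⇒Forces A (inj₁ refl) ρ∈)
  where
  open KripkeFacts M
  open WithExcludedMiddle lem
  open Restriction (Semantics.K'Nodes M α) (K'Nodes-classicallyCofinal fd α)
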